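{- Let $p\in\mathbb{N}$, let $\lambda$ and $\omega$ be partitions and let $\kappa$ be a non-empty partition, each having at most $p$ parts, and let $M\in\mathbb{N}_0$. The map $\sigma\mapsto\sigma+\kappa$ is an injective map \[[\lambda+M\kappa,\omega+M\kappa]^{(p)}\hookrightarrow[\lambda+(M+1)\kappa,\omega+(M+1)\kappa]^{(p)},\] and it is bijective provided $M\ge\mathrm{L}([\lambda,\omega]^{(p)},\kappa)$.
   Context: Partitions are sequences with trailing zeros, added componentwise; $\ell(\cdot)$ is the number of nonzero parts. For partitions $\alpha,\beta$ (possibly of different sizes) write $\alpha\trianglelefteq\beta$ if $\alpha_1+\dots+\alpha_i\le\beta_1+\dots+\beta_i$ for all $i$. The unsigned interval is $[\gamma,\delta]^{(p)}=\{\sigma \text{ partition}:\gamma\trianglelefteq\sigma\trianglelefteq\delta,\ \ell(\sigma)\le p\}$. With $\ell=\ell(\kappa)$, for $1\le k\le\ell$ let $L_k=(2\sum_{i=1}^{k-1}\omega_i+\omega_k+\omega_{k+1}-2\sum_{i=1}^k\lambda_i)/(\kappa_k-\kappa_{k+1})$ if $\kappa_k>\kappa_{k+1}$, and $L_k=0$ if $\kappa_k=\kappa_{k+1}$. Define $\mathrm{L}([\lambda,\omega]^{(p)},\kappa)=\max(L_1,\dots,L_\ell)$ if $p>\ell$, and $\mathrm{L}([\lambda,\omega]^{(p)},\kappa)=\max(L_1,\dots,L_{\ell-1},(|\omega|-|\lambda|-\omega_\ell)/\kappa_\ell)$ if $p=\ell$. -}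

module Defs where

open import Data.Nat using (ℕ; zero; suc; _+_; _*_; _∸_; _≤_; _<ᵇ_)
open import Data.Bool using (if_then_else_)
open import Data.Vec using (Vec; []; _∷_; zipWith; map)
import Data.Vec as V
open import Data.List using (List; []; _∷_; _++_; foldr; upTo)
import Data.List as L
open import Data.Integer using (ℤ; +_) renaming (_-_ to _-ℤ_)
open import Data.Rational using (ℚ; 0ℚ; _/_; _⊔_)
open import Data.Product using (_×_)

-- A partition with at most p parts is represented by the vector of its
-- first p parts (the remaining parts are all zero).
-- part v i = the (i+1)-th part (0-indexed), zero beyond position p.
part : ∀ {p} → Vec ℕ p → ℕ → ℕ
part [] i = 0
part (x ∷ v) zero = x
part (x ∷ v) (suc i) = part v i

psum : ∀ {p} → Vec ℕ p → ℕ → ℕ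
psum v zero = 0
psum v (suc k) = psum v k + part v k

IsPartition : ∀ {p} → Vec ℕ p → Set
IsPartition v = ∀ i → part v (suc i) ≤ part v i

len : ∀ {p} → Vec ℕ p → ℕ
len [] = 0
len (zero ∷ v) = len v
len (suc x ∷ v) = suc (len v)

size : ∀ {p} → Vec ℕ p → ℕ
size = V.sum

_⊴_ : ∀ {p} → Vec ℕ p → Vec ℕ p → Set
α ⊴ β = ∀ i → psum α i ≤ psum β i

_⊕_ : ∀ {p} → Vec ℕ p → Vec ℕ p → Vec ℕ p
_⊕_ = zipWith _+_

_·_ : ∀ {p} → ℕ → Vec ℕ p → Vec ℕ p
M · κ = map (M *_) κ

-- σ ∈ [γ,δ]^(p)  (ℓ(σ) ≤ p is automatic in this representation)
InInterval : ∀ {p} → Vec ℕ p → Vec ℕ p → Vec ℕ p → Set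
InInterval γ δ σ = IsPartition σ × (γ ⊴ σ) × (σ ⊴ δ)

-- L_k for k ≥ 1 (1-based), ω_k = part ω (k-1)
Lk : ∀ {p} → Vec ℕ p → Vec ℕ p → Vec ℕ p → ℕ → ℚ
Lk lam om κ k with part κ (k ∸ 1) ∸ part κ k
... | zero = 0ℚ
... | suc d = ((+ (2 * psum om (k ∸ 1) + part om (k ∸ 1) + part om k)) -ℤ (+ (2 * psum lam k))) / suc d

Ls : ∀ {p} → Vec ℕ p → Vec ℕ p → Vec ℕ p → ℕ → List ℚ
Ls lam om κ n = L.map (λ j → Lk lam om κ (suc j)) (upTo n)

Llast : ∀ {p} → Vec ℕ p → Vec ℕ p → Vec ℕ p → ℚ
Llast lam om κ with part κ (len κ ∸ 1)
... | zero = 0ℚ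
... | suc d = (((+ size om) -ℤ (+ size lam)) -ℤ (+ part om (len κ ∸ 1))) / suc d

maxList : List ℚ → ℚ
maxList [] = 0ℚ
maxList (x ∷ xs) = foldr _⊔_ x xs

Lbound : ∀ {p} → Vec ℕ p → Vec ℕ p → Vec ℕ p → ℚ
Lbound {p} lam om κ =
  if len κ <ᵇ p
  then maxList (Ls lam om κ (len κ))
  else maxList (Ls lam om κ (len κ ∸ 1) ++ (Llast lam om κ ∷ []))

-- Translation by κ preserves partitions and dominance, and dominance is cancellative, so σ ↦ σ + κ
-- maps the first interval injectively into the second. For surjectivity take τ in the second interval
-- and σ = τ − κ; the only thing to show is that every descent κ_i − κ_{i+1} is at most the descent
-- τ_i − τ_{i+1}, because then κ ≤ τ (descending from the zero tail) and τ − κ is again a partition.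
-- The descent inequality follows by adding the dominance bounds on τ at positions i, i+1, i+2 to the
-- inequality L_{i+1} ≤ M; at the last position of a κ with ℓ(κ) = p the bound (|ω|−|λ|−ω_ℓ)/κ_ℓ ≤ M
-- is used instead.
module Submission where

open import Defs
open import Data.Bool using (true; false)
open import Data.Empty using (⊥-elim)
open import Data.Integer using (ℤ; +_) renaming (_-_ to _-ℤ_)
import Data.Integer as ℤ
import Data.Integer.Properties as ℤP
open import Data.List using ([]; _∷_; foldr)
open import Data.List.Membership.Propositional using (_∈_)
open import Data.List.Membership.Propositional.Properties using (∈-map⁺; ∈-++⁺ˡ; ∈-++⁺ʳ; ∈-upTo⁺)
open import Data.List.Relation.Unary.Any using (here; there)
open import Data.Nat using (ℕ; zero; suc; _+_; _*_; _∸_; _≤_; _<_; z≤n; s≤s; _<ᵇ_; _<?_)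
open import Data.Nat.Properties
open import Data.Nat.Tactic.RingSolver using (solve-∀)
open import Data.Product using (_×_; Σ; _,_)
open import Data.Rational using (_/_; _⊔_)
import Data.Rational as Q
import Data.Rational.Properties as QP
import Data.Rational.Unnormalised as U
import Data.Rational.Unnormalised.Properties as UP
open import Data.Sum using (_⊎_; inj₁; inj₂)
open import Data.Vec using (Vec; []; _∷_; zipWith)
open import Data.Vec.Properties using (∷-injective)
open import Relation.Binary.PropositionalEquality
open import Relation.Nullary using (yes; no; ofʸ; ofⁿ)

part-⊕ : ∀ {p} (u v : Vec ℕ p) i → part (u ⊕ v) i ≡ part u i + part v i
part-⊕ [] [] i = refl
part-⊕ (x ∷ u) (y ∷ v) zero = refl
part-⊕ (x ∷ u) (y ∷ v) (suc i) = part-⊕ u v i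

part-beyond : ∀ {p} (v : Vec ℕ p) {i} → p ≤ i → part v i ≡ 0
part-beyond [] _ = refl
part-beyond (x ∷ v) (s≤s p≤i) = part-beyond v p≤i

psum-⊕ : ∀ {p} (u v : Vec ℕ p) i → psum (u ⊕ v) i ≡ psum u i + psum v i
psum-⊕ u v zero = refl
psum-⊕ u v (suc i) = begin
  psum (u ⊕ v) i + part (u ⊕ v) i         ≡⟨ cong₂ _+_ (psum-⊕ u v i) (part-⊕ u v i) ⟩
  psum u i + psum v i + (part u i + part v i) ≡⟨ +-interchange (psum u i) (psum v i) _ _ ⟩
  psum u i + part u i + (psum v i + part v i) ∎
  where
  open ≡-Reasoning
  +-interchange : ∀ a b c d → a + b + (c + d) ≡ a + c + (b + d)
  +-interchange = solve-∀

psum-cons : ∀ {p} x (v : Vec ℕ p) k → psum (x ∷ v) (suc k) ≡ x + psum v k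
psum-cons x v zero = +-comm 0 x
psum-cons x v (suc k) = trans (cong (_+ part v k) (psum-cons x v k)) (+-assoc x (psum v k) (part v k))

size≡psum : ∀ {p} (v : Vec ℕ p) → size v ≡ psum v p
size≡psum [] = refl
size≡psum {suc p} (x ∷ v) = trans (cong (_+_ x) (size≡psum v)) (sym (psum-cons x v p))

len≤length : ∀ {p} (v : Vec ℕ p) → len v ≤ p
len≤length [] = z≤n
len≤length (zero ∷ v) = m≤n⇒m≤1+n (len≤length v)
len≤length (suc x ∷ v) = s≤s (len≤length v)

IsPartition-tail : ∀ {p} x (v : Vec ℕ p) → IsPartition (x ∷ v) → IsPartition v
IsPartition-tail x v P i = P (suc i)

part≤head : ∀ {p} (v : Vec ℕ p) → IsPartition v → ∀ j → part v j ≤ part v 0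
part≤head v P zero = ≤-refl
part≤head v P (suc j) = ≤-trans (P j) (part≤head v P j)

part>0⇒<len : ∀ {p} (v : Vec ℕ p) → IsPartition v → ∀ {i} → 0 < part v i → i < len v
part>0⇒<len (suc x ∷ v) P {zero} _ = s≤s z≤n
part>0⇒<len (suc x ∷ v) P {suc i} h = s≤s (part>0⇒<len v (IsPartition-tail _ v P) h)
part>0⇒<len (zero ∷ v) P {suc i} h = ⊥-elim (<-irrefl refl (≤-trans h (≤-trans (part≤head v (IsPartition-tail 0 v P) i) (P 0))))

⊕-IsPartition : ∀ {p} (u v : Vec ℕ p) → IsPartition u → IsPartition v → IsPartition (u ⊕ v)
⊕-IsPartition u v U V i =
  subst₂ _≤_ (sym (part-⊕ u v (suc i))) (sym (part-⊕ u v i)) (+-mono-≤ (U i) (V i))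

⊕-monoˡ-⊴ : ∀ {p} {α β : Vec ℕ p} (γ : Vec ℕ p) → α ⊴ β → (α ⊕ γ) ⊴ (β ⊕ γ)
⊕-monoˡ-⊴ {α = α} {β} γ α⊴β i =
  subst₂ _≤_ (sym (psum-⊕ α γ i)) (sym (psum-⊕ β γ i)) (+-monoˡ-≤ (psum γ i) (α⊴β i))

⊕-cancelʳ-⊴ : ∀ {p} {α β : Vec ℕ p} (γ : Vec ℕ p) → (α ⊕ γ) ⊴ (β ⊕ γ) → α ⊴ β
⊕-cancelʳ-⊴ {α = α} {β} γ h i =
  +-cancelʳ-≤ (psum γ i) _ _ (subst₂ _≤_ (psum-⊕ α γ i) (psum-⊕ β γ i) (h i))

⊕-cancelʳ-≡ : ∀ {p} (σ τ κ : Vec ℕ p) → σ ⊕ κ ≡ τ ⊕ κ → σ ≡ τ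
⊕-cancelʳ-≡ [] [] [] _ = refl
⊕-cancelʳ-≡ (x ∷ σ) (y ∷ τ) (z ∷ κ) eq with ∷-injective eq
... | x+z≡y+z , σκ≡τκ = cong₂ _∷_ (+-cancelʳ-≡ z x y x+z≡y+z) (⊕-cancelʳ-≡ σ τ κ σκ≡τκ)

⊕-·-suc : ∀ {p} (lam κ : Vec ℕ p) M → (lam ⊕ (M · κ)) ⊕ κ ≡ lam ⊕ (suc M · κ)
⊕-·-suc [] [] M = refl
⊕-·-suc (x ∷ lam) (k ∷ κ) M =
  cong₂ _∷_ (trans (+-assoc x (M * k) k) (cong (_+_ x) (+-comm (M * k) k))) (⊕-·-suc lam κ M)

psum-⊕· : ∀ {p} (u v : Vec ℕ p) N i → psum (u ⊕ (N · v)) i ≡ psum u i + N * psum v i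
psum-⊕· u v N i = trans (psum-⊕ u (N · v) i) (cong (_+_ (psum u i)) (psum-· v i))
  where
  part-· : ∀ {p} (v : Vec ℕ p) i → part (N · v) i ≡ N * part v i
  part-· [] i = sym (*-zeroʳ N)
  part-· (x ∷ v) zero = refl
  part-· (x ∷ v) (suc i) = part-· v i
  psum-· : ∀ {p} (v : Vec ℕ p) i → psum (N · v) i ≡ N * psum v i
  psum-· v zero = sym (*-zeroʳ N)
  psum-· v (suc i) = trans (cong₂ _+_ (psum-· v i) (part-· v i)) (sym (*-distribˡ-+ N (psum v i) (part v i)))

InInterval-⊕ : ∀ {p} {γ δ σ κ : Vec ℕ p} → IsPartition κ →
  InInterval γ δ σ → InInterval (γ ⊕ κ) (δ ⊕ κ) (σ ⊕ κ)
InInterval-⊕ {σ = σ} {κ} K (S , γ⊴σ , σ⊴δ) = ⊕-IsPartition σ κ S K , ⊕-monoˡ-⊴ κ γ⊴σ , ⊕-monoˡ-⊴ κ σ⊴δ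

InInterval-⊕⁻ : ∀ {p} {γ δ σ κ : Vec ℕ p} → IsPartition σ →
  InInterval (γ ⊕ κ) (δ ⊕ κ) (σ ⊕ κ) → InInterval γ δ σ
InInterval-⊕⁻ {κ = κ} S (_ , lo , hi) = S , ⊕-cancelʳ-⊴ κ lo , ⊕-cancelʳ-⊴ κ hi

_⊖_ : ∀ {p} → Vec ℕ p → Vec ℕ p → Vec ℕ p
_⊖_ = zipWith _∸_

part-⊖ : ∀ {p} (u v : Vec ℕ p) i → part (u ⊖ v) i ≡ part u i ∸ part v i
part-⊖ [] [] i = refl
part-⊖ (x ∷ u) (y ∷ v) zero = refl
part-⊖ (x ∷ u) (y ∷ v) (suc i) = part-⊖ u v i

⊖-⊕-cancel : ∀ {p} (τ κ : Vec ℕ p) → (∀ i → part κ i ≤ part τ i) → (τ ⊖ κ) ⊕ κ ≡ τ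
⊖-⊕-cancel [] [] _ = refl
⊖-⊕-cancel (x ∷ τ) (y ∷ κ) κ≤τ = cong₂ _∷_ (m∸n+n≡m (κ≤τ 0)) (⊖-⊕-cancel τ κ (λ i → κ≤τ (suc i)))

-- κ_i − κ_{i+1} ≤ τ_i − τ_{i+1}, written without truncated subtraction.
DescentBelow : ∀ {p} → Vec ℕ p → Vec ℕ p → ℕ → Set
DescentBelow κ τ i = part τ (suc i) + part κ i ≤ part τ i + part κ (suc i)

_≼_ : ∀ {p} → Vec ℕ p → Vec ℕ p → Set
κ ≼ τ = ∀ i → DescentBelow κ τ i

≼⇒≤ : ∀ {p} (κ τ : Vec ℕ p) → κ ≼ τ → ∀ i → part κ i ≤ part τ i
≼⇒≤ {p} κ τ κ≼τ i = go p i (m≤n+m p i)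
  where
  go : ∀ n i → p ≤ i + n → part κ i ≤ part τ i
  go zero i p≤i = ≤-reflexive (trans (part-beyond κ p≤i′) (sym (part-beyond τ p≤i′)))
    where p≤i′ = subst (p ≤_) (+-identityʳ i) p≤i
  go (suc n) i p≤i+n = +-cancelˡ-≤ (part τ (suc i)) _ _ (begin
    part τ (suc i) + part κ i       ≤⟨ κ≼τ i ⟩
    part τ i + part κ (suc i)       ≤⟨ +-monoʳ-≤ (part τ i) (go n (suc i) (subst (p ≤_) (+-suc i n) p≤i+n)) ⟩
    part τ i + part τ (suc i)       ≡⟨ +-comm (part τ i) _ ⟩
    part τ (suc i) + part τ i       ∎)
    where open ≤-Reasoning

≼⇒⊖-IsPartition : ∀ {p} (κ τ : Vec ℕ p) → κ ≼ τ → IsPartition (τ ⊖ κ)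
≼⇒⊖-IsPartition κ τ κ≼τ i =
  subst₂ _≤_ (sym (part-⊖ τ κ (suc i))) (sym (part-⊖ τ κ i))
    (∸-descent (κ≼τ i) (≼⇒≤ κ τ κ≼τ (suc i)) (≼⇒≤ κ τ κ≼τ i))
  where
  ∸-descent : ∀ {a b c e} → b + c ≤ a + e → e ≤ b → c ≤ a → b ∸ e ≤ a ∸ c
  ∸-descent {a} {b} {c} {e} h e≤b c≤a = +-cancelʳ-≤ (e + c) _ _ (subst₂ _≤_ l r h)
    where
    l : b + c ≡ b ∸ e + (e + c)
    l = trans (cong (_+ c) (sym (m∸n+n≡m e≤b))) (+-assoc (b ∸ e) e c)
    r : a + e ≡ a ∸ c + (e + c)
    r = trans (cong (_+ e) (sym (m∸n+n≡m c≤a))) (trans (+-assoc (a ∸ c) c e) (cong (_+_ (a ∸ c)) (+-comm c e)))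

maxList-ub : ∀ {y} xs → y ∈ xs → y Q.≤ maxList xs
maxList-ub (x ∷ xs) y∈ = foldr-⊔-ub x xs y∈
  where
  foldr-⊔-ub : ∀ {y} x xs → y ∈ x ∷ xs → y Q.≤ foldr _⊔_ x xs
  foldr-⊔-ub x [] (here refl) = QP.≤-refl
  foldr-⊔-ub x (z ∷ zs) (here refl) = QP.≤-trans (foldr-⊔-ub x zs (here refl)) (QP.p≤q⊔p z _)
  foldr-⊔-ub x (z ∷ zs) (there (here refl)) = QP.p≤p⊔q z _
  foldr-⊔-ub x (z ∷ zs) (there (there y∈)) = QP.≤-trans (foldr-⊔-ub x zs (there y∈)) (QP.p≤q⊔p z _)

Lk∈Ls : ∀ {p} (lam om κ : Vec ℕ p) {n i} → i < n → Lk lam om κ (suc i) ∈ Ls lam om κ n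
Lk∈Ls lam om κ i<n = ∈-map⁺ (λ j → Lk lam om κ (suc j)) (∈-upTo⁺ i<n)

1+m<n⇒m<n∸1 : ∀ {m n} → suc m < n → m < n ∸ 1
1+m<n⇒m<n∸1 {n = suc n} (s≤s m<n) = m<n

Lk≤Lbound : ∀ {p} (lam om κ : Vec ℕ p) {i} → i < len κ → suc i < len κ ⊎ len κ < p →
  Lk lam om κ (suc i) Q.≤ Lbound lam om κ
Lk≤Lbound {p} lam om κ i<ℓ inner⊎short with len κ <ᵇ p | <ᵇ-reflects-< (len κ) p | inner⊎short
... | true  | _      | _ = maxList-ub _ (Lk∈Ls lam om κ i<ℓ)
... | false | _      | inj₁ i+1<ℓ = maxList-ub _ (∈-++⁺ˡ (Lk∈Ls lam om κ (1+m<n⇒m<n∸1 i+1<ℓ)))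
... | false | ofⁿ ℓ≮p | inj₂ ℓ<p = ⊥-elim (ℓ≮p ℓ<p)

Llast≤Lbound : ∀ {p} (lam om κ : Vec ℕ p) → len κ ≡ p → Llast lam om κ Q.≤ Lbound lam om κ
Llast≤Lbound {p} lam om κ ℓ≡p with len κ <ᵇ p | <ᵇ-reflects-< (len κ) p
... | true  | ofʸ ℓ<p = ⊥-elim (<-irrefl ℓ≡p ℓ<p)
... | false | _ = maxList-ub _ (∈-++⁺ʳ (Ls lam om κ (len κ ∸ 1)) (here refl))

-- n / suc d reduces to fromℚᵘ (mkℚᵘ n d), so the order can be read off in cross-multiplied form.
/≤⇒≤* : ∀ (n : ℤ) d M → n / suc d Q.≤ + M / 1 → n ℤ.≤ + (M * suc d)
/≤⇒≤* n d M h with UP.≤-respʳ-≃ (QP.toℚᵘ-fromℚᵘ (U.mkℚᵘ (+ M) 0))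
                    (UP.≤-respˡ-≃ (QP.toℚᵘ-fromℚᵘ (U.mkℚᵘ n d)) (QP.toℚᵘ-mono-≤ h))
... | U.*≤* n*1≤M*d = subst₂ ℤ._≤_ (ℤP.*-identityʳ n) (sym (ℤP.pos-* M (suc d))) n*1≤M*d

-≤⇒≤+ : ∀ (x : ℤ) b c → x -ℤ + b ℤ.≤ + c → x ℤ.≤ + (c + b)
-≤⇒≤+ x b c h = subst (ℤ._≤ + (c + b)) x-b+b≡x (ℤP.+-monoˡ-≤ (+ b) h)
  where
  open ≡-Reasoning
  x-b+b≡x : x -ℤ + b ℤ.+ + b ≡ x
  x-b+b≡x = begin
    x -ℤ + b ℤ.+ + b       ≡⟨ ℤP.+-assoc x (ℤ.- + b) (+ b) ⟩
    x ℤ.+ (ℤ.- + b ℤ.+ + b) ≡⟨ cong (ℤ._+_ x) (ℤP.+-inverseˡ (+ b)) ⟩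
    x ℤ.+ + 0              ≡⟨ ℤP.+-identityʳ x ⟩
    x                      ∎

Lk≤M⇒ : ∀ {p} (lam om κ : Vec ℕ p) M i d → part κ i ∸ part κ (suc i) ≡ suc d → Lk lam om κ (suc i) Q.≤ + M / 1 →
  2 * psum om i + part om i + part om (suc i) ≤ M * suc d + 2 * psum lam (suc i)
Lk≤M⇒ lam om κ M i d drop h with part κ i ∸ part κ (suc i) | drop
... | .(suc d) | refl = ℤP.drop‿+≤+ (-≤⇒≤+ _ _ _ (/≤⇒≤* _ d M h))

Llast≤M⇒ : ∀ {p} (lam om κ : Vec ℕ p) M i c → len κ ≡ suc i → part κ i ≡ suc c → Llast lam om κ Q.≤ + M / 1 →
  size om ≤ M * suc c + part om i + size lam
Llast≤M⇒ lam om κ M i c ℓ≡i+1 κᵢ h =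
  ℤP.drop‿+≤+ (-≤⇒≤+ _ _ _ (-≤⇒≤+ _ _ _ (/≤⇒≤* _ c M (subst (Q._≤ + M / 1) Llast≡ h))))
  where
  Llast≡ : Llast lam om κ ≡ (+ size om -ℤ + size lam -ℤ + part om i) / suc c
  Llast≡ = Llast-at (cong (_∸ 1) ℓ≡i+1) κᵢ
    where
    Llast-at : ∀ {j} → len κ ∸ 1 ≡ j → part κ j ≡ suc c →
      Llast lam om κ ≡ (+ size om -ℤ + size lam -ℤ + part om j) / suc c
    Llast-at refl κⱼ rewrite κⱼ = refl

-- Sum of hi at i, hi at i+2, twice lo at i+1 and the bound L_{i+1} ≤ M: all partial sums cancel.
descent-interior : ∀ {S a b x y c e D} O Λ K M → c ≡ e + D →
  S ≤ O + suc M * K →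
  S + a + b ≤ O + x + y + suc M * (K + c + e) →
  Λ + suc M * (K + c) ≤ S + a →
  2 * O + x + y ≤ M * D + 2 * Λ →
  b + c ≤ a + e
descent-interior {S} {a} {b} {x} {y} {c} {e} {D} O Λ K M refl hiᵢ hiᵢ₊₂ loᵢ₊₁ L≤M =
  subst₂ _≤_ (lhs e b D) (+-comm e a) (+-monoʳ-≤ e b+D≤a)
  where
  Z = 2 * S + a + 2 * Λ + 2 * (suc M * K) + 2 * (suc M * e) + suc M * D + M * D + 2 * O + x + y
  lhs : ∀ e b D → e + (b + D) ≡ b + (e + D)
  lhs = solve-∀
  sumL : ∀ S a b O x y Λ K e D M →
    S + a + b + ((Λ + (1 + M) * (K + (e + D))) + (Λ + (1 + M) * (K + (e + D)))) + S + (2 * O + x + y)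
    ≡ (b + D) + (2 * S + a + 2 * Λ + 2 * ((1 + M) * K) + 2 * ((1 + M) * e) + (1 + M) * D + M * D + 2 * O + x + y)
  sumL = solve-∀
  sumR : ∀ S a O x y Λ K e D M →
    O + x + y + (1 + M) * (K + (e + D) + e) + ((S + a) + (S + a)) + (O + (1 + M) * K) + (M * D + 2 * Λ)
    ≡ a + (2 * S + a + 2 * Λ + 2 * ((1 + M) * K) + 2 * ((1 + M) * e) + (1 + M) * D + M * D + 2 * O + x + y)
  sumR = solve-∀
  b+D≤a : b + D ≤ a
  b+D≤a = +-cancelʳ-≤ Z _ _ (subst₂ _≤_ (sumL S a b O x y Λ K e D M) (sumR S a O x y Λ K e D M)
            (+-mono-≤ (+-mono-≤ (+-mono-≤ hiᵢ₊₂ (+-mono-≤ loᵢ₊₁ loᵢ₊₁)) hiᵢ) L≤M))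

-- Sum of hi at i, lo at i+1 = p and the bound (|ω| − |λ| − ω_ℓ)/κ_ℓ ≤ M.
descent-last : ∀ {S a O w Λ K c} M →
  S ≤ O + suc M * K →
  Λ + suc M * (K + c) ≤ S + a →
  O + w ≤ M * c + w + Λ →
  c ≤ a
descent-last {S} {a} {O} {w} {Λ} {K} {c} M hiᵢ loₚ Llast≤M =
  +-cancelʳ-≤ Z _ _ (subst₂ _≤_ (sumL S a O w Λ K c M) (sumR S a O w Λ K c M) (+-mono-≤ (+-mono-≤ loₚ hiᵢ) Llast≤M))
  where
  Z = S + O + w + Λ + suc M * K + M * c
  sumL : ∀ S a O w Λ K c M → Λ + (1 + M) * (K + c) + S + (O + w) ≡ c + (S + O + w + Λ + (1 + M) * K + M * c)
  sumL = solve-∀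
  sumR : ∀ S a O w Λ K c M → S + a + (O + (1 + M) * K) + (M * c + w + Λ) ≡ a + (S + O + w + Λ + (1 + M) * K + M * c)
  sumR = solve-∀

module _ {p} (lam om κ τ : Vec ℕ p) (K : IsPartition κ) (T : IsPartition τ) (M : ℕ)
         (L≤M : Lbound lam om κ Q.≤ + M / 1)
         (lam⊴τ : (lam ⊕ (suc M · κ)) ⊴ τ) (τ⊴om : τ ⊴ (om ⊕ (suc M · κ))) where

  private
    lo : ∀ i → psum lam i + suc M * psum κ i ≤ psum τ i
    lo i = subst (_≤ psum τ i) (psum-⊕· lam κ (suc M) i) (lam⊴τ i)

    hi : ∀ i → psum τ i ≤ psum om i + suc M * psum κ i
    hi i = subst (psum τ i ≤_) (psum-⊕· om κ (suc M) i) (τ⊴om i)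

    κᵢ≡ : ∀ i d → part κ i ∸ part κ (suc i) ≡ suc d → part κ i ≡ part κ (suc i) + suc d
    κᵢ≡ i d drop = trans (sym (m∸n+n≡m (K i))) (trans (cong (_+ part κ (suc i)) drop) (+-comm (suc d) _))

    i<ℓ : ∀ i d → part κ i ∸ part κ (suc i) ≡ suc d → i < len κ
    i<ℓ i d drop = part>0⇒<len κ K (subst (0 <_) (sym (κᵢ≡ i d drop)) (≤-trans (s≤s z≤n) (m≤n+m (suc d) (part κ (suc i)))))

    descent-at-last : ∀ i d → part κ i ∸ part κ (suc i) ≡ suc d → suc i ≡ p → len κ ≡ p → DescentBelow κ τ i
    descent-at-last i d drop i+1≡p ℓ≡p =
      subst₂ _≤_ (cong (_+ part κ i) (sym (zero-at τ))) (trans (sym (+-identityʳ _)) (cong (_+_ (part τ i)) (sym (zero-at κ))))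
        (descent-last M (hi i) (lo (suc i))
          (subst₂ _≤_ (sizeₚ om) (cong₂ (λ c s → M * c + part om i + s) (sym κᵢ) (sizeₚ lam)) Llast≤))
      where
      sizeₚ : (v : Vec ℕ p) → size v ≡ psum v (suc i)
      sizeₚ v = trans (size≡psum v) (cong (psum v) (sym i+1≡p))
      zero-at : (v : Vec ℕ p) → part v (suc i) ≡ 0
      zero-at v = part-beyond v (≤-reflexive (sym i+1≡p))
      κᵢ : part κ i ≡ suc d
      κᵢ = trans (κᵢ≡ i d drop) (cong (_+ suc d) (zero-at κ))
      Llast≤ : size om ≤ M * suc d + part om i + size lam
      Llast≤ = Llast≤M⇒ lam om κ M i d (trans ℓ≡p (sym i+1≡p)) κᵢ (QP.≤-trans (Llast≤Lbound lam om κ ℓ≡p) L≤M)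

    descent-with-Lk : ∀ i d → part κ i ∸ part κ (suc i) ≡ suc d → suc i < len κ ⊎ len κ < p → DescentBelow κ τ i
    descent-with-Lk i d drop side =
      descent-interior (psum om i) (psum lam (suc i)) (psum κ i) M (κᵢ≡ i d drop) (hi i) (hi (suc (suc i))) (lo (suc i))
        (Lk≤M⇒ lam om κ M i d drop (QP.≤-trans (Lk≤Lbound lam om κ (i<ℓ i d drop) side) L≤M))

    descent-strict : ∀ i d → part κ i ∸ part κ (suc i) ≡ suc d → DescentBelow κ τ i
    descent-strict i d drop with suc i <? len κ | len κ <? p
    ... | yes inner | _ = descent-with-Lk i d drop (inj₁ inner)
    ... | no _ | yes short = descent-with-Lk i d drop (inj₂ short)
    ... | no outer | no full = descent-at-last i d drop (trans i+1≡ℓ ℓ≡p) ℓ≡p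
      where
      i+1≡ℓ = ≤-antisym (i<ℓ i d drop) (≮⇒≥ outer)
      ℓ≡p = ≤-antisym (len≤length κ) (≮⇒≥ full)

  descents-≼ : κ ≼ τ
  descents-≼ i with part κ i ∸ part κ (suc i) in drop
  ... | zero = +-mono-≤ (T i) (m∸n≡0⇒m≤n drop)
  ... | suc d = descent-strict i d drop

proposition9p3 : (p : ℕ) (lam om κ : Vec ℕ p) → IsPartition lam → IsPartition om → IsPartition κ → 0 < len κ → (M : ℕ) →
    ((σ : Vec ℕ p) → InInterval (lam ⊕ (M · κ)) (om ⊕ (M · κ)) σ → InInterval (lam ⊕ (suc M · κ)) (om ⊕ (suc M · κ)) (σ ⊕ κ))
    × ((σ τ : Vec ℕ p) → InInterval (lam ⊕ (M · κ)) (om ⊕ (M · κ)) σ → InInterval (lam ⊕ (M · κ)) (om ⊕ (M · κ)) τ → σ ⊕ κ ≡ τ ⊕ κ → σ ≡ τ)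
    × (Lbound lam om κ Q.≤ (+ M) / 1 → (τ : Vec ℕ p) → InInterval (lam ⊕ (suc M · κ)) (om ⊕ (suc M · κ)) τ → Σ (Vec ℕ p) (λ σ → InInterval (lam ⊕ (M · κ)) (om ⊕ (M · κ)) σ × σ ⊕ κ ≡ τ))
proposition9p3 p lam om κ _ _ K _ M = into , (λ σ τ _ _ → ⊕-cancelʳ-≡ σ τ κ) , onto
  where
  into : (σ : Vec ℕ p) → InInterval (lam ⊕ (M · κ)) (om ⊕ (M · κ)) σ → InInterval (lam ⊕ (suc M · κ)) (om ⊕ (suc M · κ)) (σ ⊕ κ)
  into σ σ∈ = subst₂ (λ γ δ → InInterval γ δ (σ ⊕ κ)) (⊕-·-suc lam κ M) (⊕-·-suc om κ M) (InInterval-⊕ K σ∈)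
  onto : Lbound lam om κ Q.≤ (+ M) / 1 → (τ : Vec ℕ p) → InInterval (lam ⊕ (suc M · κ)) (om ⊕ (suc M · κ)) τ →
    Σ (Vec ℕ p) (λ σ → InInterval (lam ⊕ (M · κ)) (om ⊕ (M · κ)) σ × σ ⊕ κ ≡ τ)
  onto L≤M τ τ∈@(T , lam⊴τ , τ⊴om) = τ ⊖ κ , InInterval-⊕⁻ (≼⇒⊖-IsPartition κ τ κ≼τ) τ∈′ , τ⊖κ⊕κ≡τ
    where
    κ≼τ : κ ≼ τ
    κ≼τ = descents-≼ lam om κ τ K T M L≤M lam⊴τ τ⊴om
    τ⊖κ⊕κ≡τ : (τ ⊖ κ) ⊕ κ ≡ τ
    τ⊖κ⊕κ≡τ = ⊖-⊕-cancel τ κ (≼⇒≤ κ τ κ≼τ)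
    τ∈′ : InInterval ((lam ⊕ (M · κ)) ⊕ κ) ((om ⊕ (M · κ)) ⊕ κ) ((τ ⊖ κ) ⊕ κ)
    τ∈′ rewrite ⊕-·-suc lam κ M | ⊕-·-suc om κ M | τ⊖κ⊕κ≡τ = τ∈
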